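{- Let $P_a$ and $P_b$ be disjoint paths with $a\ge 2$ and $b\ge 2$. Then $$\gamma_t(P_a+P_b)\le \gamma_t(P_{a+b-2}+P_2).$$
   Context: $P_n$ denotes the path on $n$ vertices, and $G+H$ denotes the disjoint union of graphs $G$ and $H$. A total dominating set of a graph without isolated vertices is a vertex set $S$ such that every vertex is adjacent to some vertex of $S$; $\gamma_t(G)$, the total domination number, is the minimum size of such a set. -}

module Defs where

open import Data.Nat using (ℕ; suc; _+_; _≤_)
open import Data.Fin using (Fin; toℕ; _↑ˡ_; _↑ʳ_)
open import Data.Fin.Subset using (Subset; _∈_; ∣_∣)
open import Data.Product using (Σ; ∃; _×_)
open import Relation.Binary.PropositionalEquality using (_≡_)
open import Level using (0ℓ)

record Graph (n : ℕ) : Set₁ where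
  field
    Adj : Fin n → Fin n → Set

open Graph public

P : (n : ℕ) → Graph n
Adj (P n) i j = (suc (toℕ i) ≡ toℕ j) ⊎' (suc (toℕ j) ≡ toℕ i)
  where
  open import Data.Sum renaming (_⊎_ to _⊎'_)

data UnionAdj {m n : ℕ} (G : Graph m) (H : Graph n) : Fin (m + n) → Fin (m + n) → Set where
  left  : ∀ {i j} → Adj G i j → UnionAdj G H (i ↑ˡ n) (j ↑ˡ n)
  right : ∀ {i j} → Adj H i j → UnionAdj G H (m ↑ʳ i) (m ↑ʳ j)

_⊕_ : {m n : ℕ} → Graph m → Graph n → Graph (m + n)
Adj (G ⊕ H) = UnionAdj G H

IsTotalDominatingSet : {n : ℕ} → Graph n → Subset n → Set
IsTotalDominatingSet {n} G S = (v : Fin n) → ∃ λ u → u ∈ S × Adj G v u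

IsTotalDominationNumber : {n : ℕ} → Graph n → ℕ → Set
IsTotalDominationNumber {n} G k =
  (Σ (Subset n) λ S → IsTotalDominatingSet G S × ∣ S ∣ ≡ k)
  × ((S : Subset n) → IsTotalDominatingSet G S → k ≤ ∣ S ∣)

-- A total dominating set S of P_{a+b-2} + P_2 contains both vertices of P_2, each being the
-- other's only neighbour.  Cover the long path by its first a and its last b vertices, which
-- overlap in two vertices x, y.  Putting x into the prefix's set and y into the suffix's set
-- (each is the neighbour of the new end vertex of its piece) and keeping S elsewhere gives
-- total dominating sets of P_a and P_b of total size |S ∩ P_{a+b-2}| + 2 = |S|.
module Submission where

open import Defs
open import Data.Nat using (ℕ; zero; suc; _+_; _∸_; _≤_; _<_; s≤s; z≤n; z<s)
open import Data.Nat.Properties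
  using (+-assoc; +-suc; +-identityʳ; +-monoʳ-<; +-cancelˡ-<; suc-injective
        ; n≤1+n; ≤-refl; ≤-trans; m<1+n⇒m<n∨m≡n; m<m+n)
open import Data.Nat.Tactic.RingSolver using (solve-∀)
open import Data.Bool using (Bool; true; false)
open import Data.Fin as Fin using (Fin; toℕ; fromℕ<; _↑ˡ_; _↑ʳ_)
open import Data.Fin.Properties using (toℕ<n; toℕ-fromℕ<; ↑ˡ-injective; ↑ʳ-injective)
import Data.Fin.Properties as Finₚ
open import Data.Fin.Subset using (Subset; _∈_; ∣_∣; ⊤)
open import Data.Vec using ([]; _∷_; _++_; tabulate; splitAt; here; there)
open import Data.Vec.Properties using (lookup-++ˡ; lookup-++ʳ; lookup∘tabulate; []=⇒lookup; lookup⇒[]=)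
open import Data.Product using (∃; _×_; _,_; proj₁; proj₂)
open import Data.Sum using (_⊎_; inj₁; inj₂)
open import Data.Empty using (⊥-elim)
open import Function using (_∘_)
open import Relation.Binary.PropositionalEquality
  using (_≡_; _≢_; refl; sym; trans; cong; cong₂; subst; module ≡-Reasoning)

boolToℕ : Bool → ℕ
boolToℕ true  = 1
boolToℕ false = 0

-- Vertex sets of the path on {0, …, n-1} are handled as predicates ℕ → Bool.
count : (ℕ → Bool) → ℕ → ℕ
count f zero    = 0
count f (suc n) = boolToℕ (f 0) + count (λ i → f (suc i)) n

count-+ : ∀ f m n → count f (m + n) ≡ count f m + count (λ i → f (m + i)) n
count-+ f zero    n = refl
count-+ f (suc m) n = trans (cong (boolToℕ (f 0) +_) (count-+ (λ i → f (suc i)) m n))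
                            (sym (+-assoc (boolToℕ (f 0)) _ _))

mark : ℕ → (ℕ → Bool) → ℕ → Bool
mark zero    f zero    = true
mark zero    f (suc k) = f (suc k)
mark (suc i) f zero    = f zero
mark (suc i) f (suc k) = mark i (λ j → f (suc j)) k

mark-self : ∀ i f → mark i f i ≡ true
mark-self zero    f = refl
mark-self (suc i) f = mark-self i (λ j → f (suc j))

mark-mono : ∀ i f k → f k ≡ true → mark i f k ≡ true
mark-mono zero    f zero    _   = refl
mark-mono zero    f (suc k) fk  = fk
mark-mono (suc i) f zero    f0  = f0
mark-mono (suc i) f (suc k) fk  = mark-mono i (λ j → f (suc j)) k fk

count-mark-prefix : ∀ m f
  → count (mark m f) (suc (suc m)) ≡ count f m + suc (boolToℕ (f (m + 1)))
count-mark-prefix zero    f = cong suc (+-identityʳ (boolToℕ (f 1)))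
count-mark-prefix (suc m) f = trans (cong (boolToℕ (f 0) +_) (count-mark-prefix m (λ j → f (suc j))))
                                    (sym (+-assoc (boolToℕ (f 0)) _ _))

count-cut : ∀ m k f →
  count (mark m f) (suc (suc m)) + count (mark 1 (λ i → f (m + i))) (suc (suc k))
    ≡ count f (m + suc (suc k)) + 2
count-cut m k f = begin
  count (mark m f) (suc (suc m)) + (x + suc r) ≡⟨ cong (_+ (x + suc r)) (count-mark-prefix m f) ⟩
  (c + suc y) + (x + suc r)                    ≡⟨ rearrange c x y r ⟩
  (c + (x + (y + r))) + 2                      ≡⟨ cong (_+ 2) (sym (count-+ f m (suc (suc k)))) ⟩
  count f (m + suc (suc k)) + 2                ∎
  where
  open ≡-Reasoning
  c x y r : ℕ
  c = count f m
  x = boolToℕ (f (m + 0))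
  y = boolToℕ (f (m + 1))
  r = count (λ i → f (m + suc (suc i))) k
  rearrange : ∀ c x y r → (c + suc y) + (x + suc r) ≡ (c + (x + (y + r))) + 2
  rearrange = solve-∀

-- Adj (P n) i j is definitionally Consecutive (toℕ i) (toℕ j).
Consecutive : ℕ → ℕ → Set
Consecutive t u = suc t ≡ u ⊎ suc u ≡ t

TotallyDominates : ℕ → (ℕ → Bool) → Set
TotallyDominates n f = ∀ v → v < n → ∃ λ u → u < n × Consecutive v u × f u ≡ true

consecutive-≤ : ∀ {t u} → Consecutive t u → u ≤ suc t
consecutive-≤ (inj₁ refl) = ≤-refl
consecutive-≤ {u = u} (inj₂ refl) = ≤-trans (n≤1+n u) (n≤1+n (suc u))

consecutive-shift : ∀ k {t u} → Consecutive (k + suc t) u → ∃ λ w → u ≡ k + w × Consecutive (suc t) w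
consecutive-shift k {t} (inj₁ refl) = suc (suc t) , sym (+-suc k (suc t)) , inj₁ refl
consecutive-shift k {t} (inj₂ e)    = t , suc-injective (trans e (+-suc k t)) , inj₂ refl

totallyDominates-prefix : ∀ m k f → TotallyDominates (m + suc (suc k)) f
  → TotallyDominates (suc (suc m)) (mark m f)
totallyDominates-prefix m k f dom v v< with m<1+n⇒m<n∨m≡n v<
... | inj₂ refl = m , n≤1+n (suc m) , inj₂ refl , mark-self m f
... | inj₁ v<1+m with dom v (≤-trans v<1+m (m<m+n m z<s))
...   | u , _ , adj , fu = u , s≤s (≤-trans (consecutive-≤ adj) v<1+m) , adj , mark-mono m f u fu

totallyDominates-suffix : ∀ m k f → TotallyDominates (m + suc (suc k)) f
  → TotallyDominates (suc (suc k)) (mark 1 (λ i → f (m + i)))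
totallyDominates-suffix m k f dom zero    _  = 1 , s≤s (s≤s z≤n) , inj₁ refl , refl
totallyDominates-suffix m k f dom (suc t) t< with dom (m + suc t) (+-monoʳ-< m t<)
... | u , u< , adj , fu with consecutive-shift m adj
...   | w , refl , adj′ = w , +-cancelˡ-< m _ _ u< , adj′ , mark-mono 1 (λ i → f (m + i)) w fu

data Side (m n : ℕ) : Fin (m + n) → Set where
  onLeft  : ∀ i → Side m n (i ↑ˡ n)
  onRight : ∀ j → Side m n (m ↑ʳ j)

side : ∀ m n (v : Fin (m + n)) → Side m n v
side zero    n v           = onRight v
side (suc m) n Fin.zero    = onLeft Fin.zero
side (suc m) n (Fin.suc v) with side m n v
... | onLeft i  = onLeft (Fin.suc i)
... | onRight j = onRight j

↑ˡ≢↑ʳ : ∀ {m n} (i : Fin m) (j : Fin n) → i ↑ˡ n ≢ m ↑ʳ j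
↑ˡ≢↑ʳ {suc m} Fin.zero    j ()
↑ˡ≢↑ʳ {suc m} (Fin.suc i) j e = ↑ˡ≢↑ʳ i j (Finₚ.suc-injective e)

module _ {m n : ℕ} (S : Subset m) (T : Subset n) where

  ∈-++⁺ˡ : ∀ {i} → i ∈ S → i ↑ˡ n ∈ S ++ T
  ∈-++⁺ˡ {i} i∈S = lookup⇒[]= _ _ (trans (lookup-++ˡ S T i) ([]=⇒lookup i∈S))

  ∈-++⁺ʳ : ∀ {j} → j ∈ T → m ↑ʳ j ∈ S ++ T
  ∈-++⁺ʳ {j} j∈T = lookup⇒[]= _ _ (trans (lookup-++ʳ S T j) ([]=⇒lookup j∈T))

  ∈-++⁻ˡ : ∀ {i} → i ↑ˡ n ∈ S ++ T → i ∈ S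
  ∈-++⁻ˡ {i} i∈ = lookup⇒[]= _ _ (trans (sym (lookup-++ˡ S T i)) ([]=⇒lookup i∈))

  ∈-++⁻ʳ : ∀ {j} → m ↑ʳ j ∈ S ++ T → j ∈ T
  ∈-++⁻ʳ {j} j∈ = lookup⇒[]= _ _ (trans (sym (lookup-++ʳ S T j)) ([]=⇒lookup j∈))

∣p++q∣≡∣p∣+∣q∣ : ∀ {m n} (S : Subset m) (T : Subset n) → ∣ S ++ T ∣ ≡ ∣ S ∣ + ∣ T ∣
∣p++q∣≡∣p∣+∣q∣ []          T = refl
∣p++q∣≡∣p∣+∣q∣ (true ∷ S)  T = cong suc (∣p++q∣≡∣p∣+∣q∣ S T)
∣p++q∣≡∣p∣+∣q∣ (false ∷ S) T = ∣p++q∣≡∣p∣+∣q∣ S T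

module _ {m n : ℕ} {G : Graph m} {H : Graph n} where

  ⊕-adj-↑ˡ : ∀ {i w} → Adj (G ⊕ H) (i ↑ˡ n) w → ∃ λ j → w ≡ j ↑ˡ n × Adj G i j
  ⊕-adj-↑ˡ = invert refl
    where
    invert : ∀ {i v w} → v ≡ i ↑ˡ n → UnionAdj G H v w → ∃ λ j → w ≡ j ↑ˡ n × Adj G i j
    invert e (left p)  = _ , refl , subst (λ k → Adj G k _) (↑ˡ-injective n _ _ e) p
    invert e (right p) = ⊥-elim (↑ˡ≢↑ʳ _ _ (sym e))

  ⊕-adj-↑ʳ : ∀ {j w} → Adj (G ⊕ H) (m ↑ʳ j) w → ∃ λ k → w ≡ m ↑ʳ k × Adj H j k
  ⊕-adj-↑ʳ = invert refl
    where
    invert : ∀ {j v w} → v ≡ m ↑ʳ j → UnionAdj G H v w → ∃ λ k → w ≡ m ↑ʳ k × Adj H j k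
    invert e (left p)  = ⊥-elim (↑ˡ≢↑ʳ _ _ e)
    invert e (right p) = _ , refl , subst (λ k → Adj H k _) (↑ʳ-injective m _ _ e) p

  ⊕-tds : ∀ {S T} → IsTotalDominatingSet G S → IsTotalDominatingSet H T
    → IsTotalDominatingSet (G ⊕ H) (S ++ T)
  ⊕-tds {S} {T} domG domH v with side m n v
  ... | onLeft i  = let u , u∈S , adj = domG i in u ↑ˡ n , ∈-++⁺ˡ S T u∈S , left adj
  ... | onRight j = let u , u∈T , adj = domH j in m ↑ʳ u , ∈-++⁺ʳ S T u∈T , right adj

  ⊕-tds⁻ : ∀ {S T} → IsTotalDominatingSet (G ⊕ H) (S ++ T)
    → IsTotalDominatingSet G S × IsTotalDominatingSet H T
  proj₁ (⊕-tds⁻ {S} {T} dom) i with dom (i ↑ˡ n)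
  ... | _ , u∈ , adj with ⊕-adj-↑ˡ adj
  ...   | u , refl , adj′ = u , ∈-++⁻ˡ S T u∈ , adj′
  proj₂ (⊕-tds⁻ {S} {T} dom) j with dom (m ↑ʳ j)
  ... | _ , u∈ , adj with ⊕-adj-↑ʳ adj
  ...   | u , refl , adj′ = u , ∈-++⁻ʳ S T u∈ , adj′

indicator : ∀ {n} → Subset n → ℕ → Bool
indicator []      _       = false
indicator (x ∷ S) zero    = x
indicator (x ∷ S) (suc k) = indicator S k

indicator-∈ : ∀ {n} {S : Subset n} {u} → u ∈ S → indicator S (toℕ u) ≡ true
indicator-∈ here        = refl
indicator-∈ (there u∈S) = indicator-∈ u∈S

∣p∣≡count-indicator : ∀ {n} (S : Subset n) → ∣ S ∣ ≡ count (indicator S) n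
∣p∣≡count-indicator []          = refl
∣p∣≡count-indicator (true ∷ S)  = cong suc (∣p∣≡count-indicator S)
∣p∣≡count-indicator (false ∷ S) = ∣p∣≡count-indicator S

∈-tabulate : ∀ {n} f {u : Fin n} → f (toℕ u) ≡ true → u ∈ tabulate (f ∘ toℕ)
∈-tabulate f {u} fu = lookup⇒[]= u _ (trans (lookup∘tabulate (f ∘ toℕ) u) fu)

∣tabulate∣≡count : ∀ n f → ∣ tabulate {n = n} (f ∘ toℕ) ∣ ≡ count f n
∣tabulate∣≡count zero    f = refl
∣tabulate∣≡count (suc n) f with f 0
... | true  = cong suc (∣tabulate∣≡count n (λ i → f (suc i)))
... | false = ∣tabulate∣≡count n (λ i → f (suc i))

tds⇒totallyDominates : ∀ {n} {S : Subset n} → IsTotalDominatingSet (P n) S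
  → TotallyDominates n (indicator S)
tds⇒totallyDominates dom v v< with dom (fromℕ< v<)
... | u , u∈S , adj =
  toℕ u , toℕ<n u , subst (λ t → Consecutive t (toℕ u)) (toℕ-fromℕ< v<) adj , indicator-∈ u∈S

totallyDominates⇒tds : ∀ {n} f → TotallyDominates n f
  → IsTotalDominatingSet (P n) (tabulate (f ∘ toℕ))
totallyDominates⇒tds f dom v with dom (toℕ v) (toℕ<n v)
... | w , w< , adj , fw =
  fromℕ< w< , ∈-tabulate f (subst (λ k → f k ≡ true) (sym (toℕ-fromℕ< w<)) fw)
            , subst (Consecutive (toℕ v)) (sym (toℕ-fromℕ< w<)) adj

P₂-tds⇒⊤ : ∀ {T : Subset 2} → IsTotalDominatingSet (P 2) T → T ≡ ⊤
P₂-tds⇒⊤ {x ∷ y ∷ []} dom with dom Fin.zero | dom (Fin.suc Fin.zero)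
... | Fin.zero , _ , inj₁ () | _
... | Fin.zero , _ , inj₂ () | _
... | _ | Fin.suc Fin.zero , _ , inj₁ ()
... | _ | Fin.suc Fin.zero , _ , inj₂ ()
... | Fin.suc Fin.zero , there here , _ | Fin.zero , here , _ = refl

tds-cut : ∀ m k (S : Subset (m + suc (suc k))) → IsTotalDominatingSet (P (m + suc (suc k))) S
  → ∃ λ (S′ : Subset (suc (suc m) + suc (suc k)))
      → IsTotalDominatingSet (P (suc (suc m)) ⊕ P (suc (suc k))) S′ × ∣ S′ ∣ ≡ ∣ S ∣ + 2
tds-cut m k S domS = Sm ++ Sk , domS′ , ∣S′∣≡∣S∣+2
  where
  open ≡-Reasoning
  g L R : ℕ → Bool
  g = indicator S
  L = mark m g
  R = mark 1 (λ i → g (m + i))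

  domg : TotallyDominates (m + suc (suc k)) g
  domg = tds⇒totallyDominates domS

  Sm : Subset (suc (suc m))
  Sm = tabulate (L ∘ toℕ)

  Sk : Subset (suc (suc k))
  Sk = tabulate (R ∘ toℕ)

  domS′ : IsTotalDominatingSet (P (suc (suc m)) ⊕ P (suc (suc k))) (Sm ++ Sk)
  domS′ = ⊕-tds {G = P (suc (suc m))} {H = P (suc (suc k))}
                (totallyDominates⇒tds L (totallyDominates-prefix m k g domg))
                (totallyDominates⇒tds R (totallyDominates-suffix m k g domg))

  ∣S′∣≡∣S∣+2 : ∣ Sm ++ Sk ∣ ≡ ∣ S ∣ + 2
  ∣S′∣≡∣S∣+2 = begin
    ∣ Sm ++ Sk ∣                                  ≡⟨ ∣p++q∣≡∣p∣+∣q∣ Sm Sk ⟩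
    ∣ Sm ∣ + ∣ Sk ∣                               ≡⟨ cong₂ _+_ (∣tabulate∣≡count (suc (suc m)) L) (∣tabulate∣≡count (suc (suc k)) R) ⟩
    count L (suc (suc m)) + count R (suc (suc k)) ≡⟨ count-cut m k g ⟩
    count g (m + suc (suc k)) + 2                 ≡⟨ cong (_+ 2) (sym (∣p∣≡count-indicator S)) ⟩
    ∣ S ∣ + 2                                     ∎

corollary3p3 : (a b : ℕ) → 2 ≤ a → 2 ≤ b → (k₁ k₂ : ℕ)
    → IsTotalDominationNumber (P a ⊕ P b) k₁
    → IsTotalDominationNumber (P (a + b ∸ 2) ⊕ P 2) k₂
    → k₁ ≤ k₂
corollary3p3 zero          _ ()
corollary3p3 (suc zero)    _ (s≤s ())
corollary3p3 (suc (suc a)) zero          _ ()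
corollary3p3 (suc (suc a)) (suc zero)    _ (s≤s ())
corollary3p3 (suc (suc a)) (suc (suc b)) _ _ k₁ k₂ (_ , minimal) ((S , domS , ∣S∣≡k₂) , _)
  with splitAt (a + suc (suc b)) S
... | xs , T , refl with ⊕-tds⁻ {G = P (a + suc (suc b))} {H = P 2} domS
...   | domxs , domT with tds-cut a b xs domxs
...     | S′ , domS′ , ∣S′∣≡∣xs∣+2 = subst (k₁ ≤_) ∣S′∣≡k₂ (minimal S′ domS′)
  where
  open ≡-Reasoning
  ∣S′∣≡k₂ : ∣ S′ ∣ ≡ k₂
  ∣S′∣≡k₂ = begin
    ∣ S′ ∣         ≡⟨ ∣S′∣≡∣xs∣+2 ⟩
    ∣ xs ∣ + 2     ≡⟨ cong (λ U → ∣ xs ∣ + ∣ U ∣) (sym (P₂-tds⇒⊤ domT)) ⟩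
    ∣ xs ∣ + ∣ T ∣ ≡⟨ sym (∣p++q∣≡∣p∣+∣q∣ xs T) ⟩
    ∣ xs ++ T ∣    ≡⟨ ∣S∣≡k₂ ⟩
    k₂             ∎
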